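{- The following three categories are equivalent: 1. $\mathsf{MTL}_{div}$, the full subcategory of MTL-algebras without zero divisors; 2. $\mathsf{GMTL}$, the category of GMTL-algebras and their homomorphisms; 3. $\mathsf{SMTL}_{ind}$, the full subcategory of directly indecomposable SMTL-algebras.
   Context: **Algebras.** - A GMTL-algebra is a commutative integral residuated lattice $(A,\wedge,\vee,\cdot,\to,1)$ whose lattice reduct is distributive and which satisfies $(a\to b)\vee(b\to a)=1$. Here integral means $1$ is the top, and $a\cdot b\le c\iff b\le a\to c$. - An MTL-algebra is an expansion of a GMTL-algebra by a constant $0$ denoting the least element. Write $\neg a=a\to 0$. - An SMTL-algebra is an MTL-algebra satisfying $a\wedge\neg a=0$. - An MTL-algebra has no zero divisors if $a\cdot b=0$ implies $a=0$ or $b=0$. **Categories.** Morphisms are homomorphisms in the respective signatures: $\{\wedge,\vee,\cdot,\to,1\}$ for GMTL-algebras, and $\{\wedge,\vee,\cdot,\to,1,0\}$ for MTL- and SMTL-algebras. -}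

module Defs where

open import Level using (Level; 0ℓ; _⊔_) renaming (suc to lsuc)
open import Relation.Binary.Core using (Rel)
open import Relation.Binary.Structures using (IsEquivalence)
open import Algebra.Core using (Op₂)
open import Data.Product using (Σ; _×_; _,_; proj₁; proj₂)
open import Data.Sum using (_⊎_)
open import Relation.Nullary using (¬_)
import Algebra.Structures as AS
import Algebra.Lattice.Structures as LS

record IsGMTL {A : Set} (_≈_ : Rel A 0ℓ)
              (_∧_ _∨_ _·_ _⇒_ : Op₂ A) (𝟏 : A) : Set where
  _≤_ : A → A → Set
  x ≤ y = (x ∧ y) ≈ x
  field
    isDistributiveLattice : LS.IsDistributiveLattice _≈_ _∨_ _∧_
    isCommutativeMonoid   : AS.IsCommutativeMonoid _≈_ _·_ 𝟏
    ⇒-cong      : ∀ {x x′ y y′} → x ≈ x′ → y ≈ y′ → (x ⇒ y) ≈ (x′ ⇒ y′)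
    integral    : ∀ x → x ≤ 𝟏
    residuation : ∀ x y z → ((x · y) ≤ z → y ≤ (x ⇒ z)) × (y ≤ (x ⇒ z) → (x · y) ≤ z)
    prelinear   : ∀ x y → ((x ⇒ y) ∨ (y ⇒ x)) ≈ 𝟏

record GMTL : Set₁ where
  infix  4 _≈_
  field
    Carrier : Set
    _≈_     : Rel Carrier 0ℓ
    _∧_ _∨_ _·_ _⇒_ : Op₂ Carrier
    𝟏       : Carrier
    isGMTL  : IsGMTL _≈_ _∧_ _∨_ _·_ _⇒_ 𝟏
  open IsGMTL isGMTL public

  isEquivalence : IsEquivalence _≈_
  isEquivalence = LS.IsDistributiveLattice.isEquivalence isDistributiveLattice

record MTL : Set₁ where
  field
    gmtl : GMTL
  open GMTL gmtl public
  field
    𝟎      : Carrier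
    bottom : ∀ x → 𝟎 ≤ x

  ∼_ : Carrier → Carrier
  ∼ x = x ⇒ 𝟎

record SMTL : Set₁ where
  field
    mtl : MTL
  open MTL mtl public
  field
    pseudocomplement : ∀ x → (x ∧ (∼ x)) ≈ 𝟎

record GMTLHom (A B : GMTL) : Set where
  private
    module A = GMTL A
    module B = GMTL B
  field
    ⟦_⟧    : A.Carrier → B.Carrier
    cong   : ∀ {x y} → x A.≈ y → ⟦ x ⟧ B.≈ ⟦ y ⟧
    pres-∧ : ∀ x y → ⟦ x A.∧ y ⟧ B.≈ (⟦ x ⟧ B.∧ ⟦ y ⟧)
    pres-∨ : ∀ x y → ⟦ x A.∨ y ⟧ B.≈ (⟦ x ⟧ B.∨ ⟦ y ⟧)
    pres-· : ∀ x y → ⟦ x A.· y ⟧ B.≈ (⟦ x ⟧ B.· ⟦ y ⟧)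
    pres-⇒ : ∀ x y → ⟦ x A.⇒ y ⟧ B.≈ (⟦ x ⟧ B.⇒ ⟦ y ⟧)
    pres-𝟏 : ⟦ A.𝟏 ⟧ B.≈ B.𝟏

record MTLHom (A B : MTL) : Set where
  private
    module A = MTL A
    module B = MTL B
  field
    hom    : GMTLHom A.gmtl B.gmtl
  open GMTLHom hom public
  field
    pres-𝟎 : ⟦ A.𝟎 ⟧ B.≈ B.𝟎

record Category (o h e : Level) : Set (lsuc (o ⊔ h ⊔ e)) where
  infixr 9 _∘_
  infix  4 _≈_
  field
    Obj   : Set o
    Hom   : Obj → Obj → Set h
    _≈_   : ∀ {A B} → Rel (Hom A B) e
    id    : ∀ {A} → Hom A A
    _∘_   : ∀ {A B C} → Hom B C → Hom A B → Hom A C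
    ≈-equiv : ∀ {A B} → IsEquivalence (_≈_ {A} {B})
    ∘-cong  : ∀ {A B C} {f f′ : Hom B C} {g g′ : Hom A B} →
              f ≈ f′ → g ≈ g′ → (f ∘ g) ≈ (f′ ∘ g′)
    assoc   : ∀ {A B C D} (f : Hom C D) (g : Hom B C) (k : Hom A B) →
              ((f ∘ g) ∘ k) ≈ (f ∘ (g ∘ k))
    identityˡ : ∀ {A B} (f : Hom A B) → (id ∘ f) ≈ f
    identityʳ : ∀ {A B} (f : Hom A B) → (f ∘ id) ≈ f

record Functor {o h e o′ h′ e′}
               (C : Category o h e) (D : Category o′ h′ e′)
               : Set (o ⊔ h ⊔ e ⊔ o′ ⊔ h′ ⊔ e′) where
  private
    module C = Category C
    module D = Category D
  field
    F₀ : C.Obj → D.Obj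
    F₁ : ∀ {A B} → C.Hom A B → D.Hom (F₀ A) (F₀ B)
    F-cong : ∀ {A B} {f g : C.Hom A B} → f C.≈ g → F₁ f D.≈ F₁ g
    F-id   : ∀ {A} → F₁ (C.id {A}) D.≈ D.id
    F-∘    : ∀ {A B C′} (f : C.Hom B C′) (g : C.Hom A B) →
             F₁ (f C.∘ g) D.≈ (F₁ f D.∘ F₁ g)

idF : ∀ {o h e} (C : Category o h e) → Functor C C
idF C = record
  { F₀ = λ A → A ; F₁ = λ f → f ; F-cong = λ p → p
  ; F-id = IsEquivalence.refl ≈-equiv
  ; F-∘ = λ f g → IsEquivalence.refl ≈-equiv }
  where open Category C

_∘F_ : ∀ {o h e o′ h′ e′ o″ h″ e″}
         {C : Category o h e} {D : Category o′ h′ e′} {E : Category o″ h″ e″} →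
       Functor D E → Functor C D → Functor C E
_∘F_ {E = E} G F = record
  { F₀ = λ A → G.F₀ (F.F₀ A)
  ; F₁ = λ f → G.F₁ (F.F₁ f)
  ; F-cong = λ p → G.F-cong (F.F-cong p)
  ; F-id = IsEquivalence.trans E.≈-equiv (G.F-cong F.F-id) G.F-id
  ; F-∘ = λ f g → IsEquivalence.trans E.≈-equiv (G.F-cong (F.F-∘ f g)) (G.F-∘ _ _)
  }
  where
    module G = Functor G
    module F = Functor F
    module E = Category E

record NatIso {o h e o′ h′ e′} {C : Category o h e} {D : Category o′ h′ e′}
              (F G : Functor C D) : Set (o ⊔ h ⊔ e ⊔ o′ ⊔ h′ ⊔ e′) where
  private
    module C = Category C
    module D = Category D
    module F = Functor F
    module G = Functor G
  field
    η     : ∀ A → D.Hom (F.F₀ A) (G.F₀ A)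
    η⁻¹   : ∀ A → D.Hom (G.F₀ A) (F.F₀ A)
    isoˡ  : ∀ A → (η⁻¹ A D.∘ η A) D.≈ D.id
    isoʳ  : ∀ A → (η A D.∘ η⁻¹ A) D.≈ D.id
    natural : ∀ {A B} (f : C.Hom A B) → (η B D.∘ F.F₁ f) D.≈ (G.F₁ f D.∘ η A)

record Equivalence {o h e o′ h′ e′}
                   (C : Category o h e) (D : Category o′ h′ e′)
                   : Set (o ⊔ h ⊔ e ⊔ o′ ⊔ h′ ⊔ e′) where
  field
    F : Functor C D
    G : Functor D C
    unit   : NatIso (idF C) (G ∘F F)
    counit : NatIso (F ∘F G) (idF D)

FullSubcategory : ∀ {o h e p} (C : Category o h e) →
                  (Category.Obj C → Set p) → Category (o ⊔ p) h e
FullSubcategory C P = record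
  { Obj = Σ Obj P
  ; Hom = λ A B → Hom (proj₁ A) (proj₁ B)
  ; _≈_ = _≈_
  ; id = id
  ; _∘_ = _∘_
  ; ≈-equiv = ≈-equiv
  ; ∘-cong = ∘-cong
  ; assoc = assoc
  ; identityˡ = identityˡ
  ; identityʳ = identityʳ
  }
  where open Category C

GMTLcat : Category (lsuc 0ℓ) 0ℓ 0ℓ
GMTLcat = record
  { Obj = GMTL
  ; Hom = GMTLHom
  ; _≈_ = λ {A} {B} f g → ∀ x → GMTL._≈_ B (GMTLHom.⟦_⟧ f x) (GMTLHom.⟦_⟧ g x)
  ; id = λ {A} → idH A
  ; _∘_ = compH
  ; ≈-equiv = λ {A} {B} → record
      { refl = λ x → reflB B
      ; sym = λ p x → IsEquivalence.sym (GMTL.isEquivalence B) (p x)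
      ; trans = λ p q x → IsEquivalence.trans (GMTL.isEquivalence B) (p x) (q x) }
  ; ∘-cong = λ {A} {B} {C} {f} {f′} {g} {g′} p q x →
      IsEquivalence.trans (GMTL.isEquivalence C) (GMTLHom.cong f (q x)) (p _)
  ; assoc = λ {D = D} f g k x → reflB D
  ; identityˡ = λ {B = B} f x → reflB B
  ; identityʳ = λ {B = B} f x → reflB B
  }
  where
    reflB : ∀ (B : GMTL) {x} → GMTL._≈_ B x x
    reflB B = IsEquivalence.refl (GMTL.isEquivalence B)
    idH : ∀ A → GMTLHom A A
    idH A = record
      { ⟦_⟧ = λ x → x ; cong = λ p → p
      ; pres-∧ = λ x y → reflB A ; pres-∨ = λ x y → reflB A
      ; pres-· = λ x y → reflB A ; pres-⇒ = λ x y → reflB A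
      ; pres-𝟏 = reflB A }
    compH : ∀ {A B C} → GMTLHom B C → GMTLHom A B → GMTLHom A C
    compH {A} {B} {C} f g = record
      { ⟦_⟧ = λ x → f.⟦ g.⟦ x ⟧ ⟧
      ; cong = λ p → f.cong (g.cong p)
      ; pres-∧ = λ x y → tr (f.cong (g.pres-∧ x y)) (f.pres-∧ _ _)
      ; pres-∨ = λ x y → tr (f.cong (g.pres-∨ x y)) (f.pres-∨ _ _)
      ; pres-· = λ x y → tr (f.cong (g.pres-· x y)) (f.pres-· _ _)
      ; pres-⇒ = λ x y → tr (f.cong (g.pres-⇒ x y)) (f.pres-⇒ _ _)
      ; pres-𝟏 = tr (f.cong g.pres-𝟏) f.pres-𝟏 }
      where
        module f = GMTLHom f
        module g = GMTLHom g
        tr = IsEquivalence.trans (GMTL.isEquivalence C)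

MTLcat : Category (lsuc 0ℓ) 0ℓ 0ℓ
MTLcat = record
  { Obj = MTL
  ; Hom = MTLHom
  ; _≈_ = λ f g → G._≈_ (MTLHom.hom f) (MTLHom.hom g)
  ; id = λ {A} → record { hom = G.id ; pres-𝟎 = IsEquivalence.refl (MTL.isEquivalence A) }
  ; _∘_ = λ {A} {B} {C} f g → record
      { hom = MTLHom.hom f G.∘ MTLHom.hom g
      ; pres-𝟎 = IsEquivalence.trans (MTL.isEquivalence C)
                   (MTLHom.cong f (MTLHom.pres-𝟎 g)) (MTLHom.pres-𝟎 f) }
  ; ≈-equiv = λ {A} {B} → record
      { refl = λ {f} → IsEquivalence.refl (G.≈-equiv {MTL.gmtl A} {MTL.gmtl B}) {MTLHom.hom f}
      ; sym = λ {f} {g} p → IsEquivalence.sym (G.≈-equiv {MTL.gmtl A} {MTL.gmtl B})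
                 {MTLHom.hom f} {MTLHom.hom g} p
      ; trans = λ {f} {g} {k} p q → IsEquivalence.trans (G.≈-equiv {MTL.gmtl A} {MTL.gmtl B})
                 {MTLHom.hom f} {MTLHom.hom g} {MTLHom.hom k} p q }
  ; ∘-cong = λ {f = f} {f′} {g} {g′} p q →
      G.∘-cong {f = MTLHom.hom f} {MTLHom.hom f′} {MTLHom.hom g} {MTLHom.hom g′} p q
  ; assoc = λ f g k → G.assoc (MTLHom.hom f) (MTLHom.hom g) (MTLHom.hom k)
  ; identityˡ = λ f → G.identityˡ (MTLHom.hom f)
  ; identityʳ = λ f → G.identityʳ (MTLHom.hom f)
  }
  where module G = Category GMTLcat

SMTLcat : Category (lsuc 0ℓ) 0ℓ 0ℓ
SMTLcat = record
  { Obj = SMTL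
  ; Hom = λ A B → MTLHom (SMTL.mtl A) (SMTL.mtl B)
  ; _≈_ = M._≈_
  ; id = M.id
  ; _∘_ = M._∘_
  ; ≈-equiv = λ {A} {B} → M.≈-equiv {SMTL.mtl A} {SMTL.mtl B}
  ; ∘-cong = λ {A} {B} {C} {f} {f′} {g} {g′} p q →
      M.∘-cong {SMTL.mtl A} {SMTL.mtl B} {SMTL.mtl C} {f} {f′} {g} {g′} p q
  ; assoc = M.assoc
  ; identityˡ = M.identityˡ
  ; identityʳ = M.identityʳ
  }
  where module M = Category MTLcat

Nontrivial : MTL → Set
Nontrivial A = ¬ (MTL._≈_ A (MTL.𝟎 A) (MTL.𝟏 A))

Trivial : MTL → Set
Trivial A = ∀ x y → MTL._≈_ A x y

NoZeroDivisors : MTL → Set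
NoZeroDivisors A = Nontrivial A ×
  (∀ x y → MTL._≈_ A (MTL._·_ A x y) (MTL.𝟎 A) →
           MTL._≈_ A x (MTL.𝟎 A) ⊎ MTL._≈_ A y (MTL.𝟎 A))

-- A is isomorphic to the direct product B × C: there are homomorphisms
-- p : A → B, q : A → C such that ⟨p , q⟩ : A → B × C has an inverse
-- (a ≈-respecting map B × C → A); written out componentwise.
IsoToProduct : (A B C : MTL) → Set
IsoToProduct A B C =
  Σ (MTLHom A B) λ p → Σ (MTLHom A C) λ q →
  Σ (MTL.Carrier B → MTL.Carrier C → MTL.Carrier A) λ g →
    (∀ {b b′ c c′} → MTL._≈_ B b b′ → MTL._≈_ C c c′ → MTL._≈_ A (g b c) (g b′ c′)) ×
    (∀ b c → MTL._≈_ B (MTLHom.⟦_⟧ p (g b c)) b) ×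
    (∀ b c → MTL._≈_ C (MTLHom.⟦_⟧ q (g b c)) c) ×
    (∀ a → MTL._≈_ A (g (MTLHom.⟦_⟧ p a) (MTLHom.⟦_⟧ q a)) a)

DirectlyIndecomposable : SMTL → Set₁
DirectlyIndecomposable A = Nontrivial (SMTL.mtl A) ×
  (∀ (B C : SMTL) → IsoToProduct (SMTL.mtl A) (SMTL.mtl B) (SMTL.mtl C) →
     Trivial (SMTL.mtl B) ⊎ Trivial (SMTL.mtl C))

MTLdiv : Category (lsuc 0ℓ) 0ℓ 0ℓ
MTLdiv = FullSubcategory MTLcat NoZeroDivisors

SMTLind : Category (lsuc 0ℓ) 0ℓ 0ℓ
SMTLind = FullSubcategory SMTLcat DirectlyIndecomposable

module Submission where

-- The functors are B ↦ 𝟐 ⊕ B, adjoining a new bottom to a GMTL-algebra, and A ↦ D(A), the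
-- GMTL-algebra of dense elements (∼ x ≈ 𝟎) of an MTL-algebra. Always B ≅ D(𝟐 ⊕ B); conversely
-- 𝟐 ⊕ D(A) → A is an isomorphism as soon as A is nontrivial and every element is 𝟎 or dense.
-- This dichotomy holds without zero divisors because x · ∼ x ≈ 𝟎. In an SMTL-algebra ∼ x and
-- ∼ ∼ x are complementary and so split it into a direct product; if it is indecomposable one
-- factor is trivial, which means ∼ x ≈ 𝟎 or ∼ ∼ x ≈ 𝟎. Finally 𝟐 ⊕ B has no zero divisors and,
-- satisfying the dichotomy, is directly indecomposable.

open import Defs
open import Level using (0ℓ) renaming (suc to lsuc)
open import Data.Product using (Σ; _×_; _,_; proj₁; proj₂)
open import Data.Sum using (_⊎_; inj₁; inj₂; [_,_]′)
open import Data.Empty using (⊥-elim)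
open import Data.Maybe.Base using (Maybe; just; nothing; zipWith)
open import Data.Maybe.Relation.Binary.Pointwise as Pointwise using (Pointwise; just; nothing)
open import Relation.Nullary using (¬_)
open import Relation.Binary.Core using (Rel)
open import Relation.Binary.Bundles using (Setoid; Poset)
open import Relation.Binary.Structures using (IsEquivalence)
open import Algebra.Core using (Op₂)
open import Algebra.Lattice.Bundles using (Lattice)
open import Algebra.Consequences.Setoid using (comm∧distrˡ⇒distr)
open import Axiom.ExcludedMiddle using (ExcludedMiddle)
import Algebra.Structures as AS
import Algebra.Lattice.Structures as LS
import Algebra.Lattice.Properties.Lattice as LatticeProperties
import Relation.Binary.Reasoning.PartialOrder as PosetReasoning
import Relation.Binary.Reasoning.Setoid as SetoidReasoning

module GMTLProperties (A : GMTL) where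
  open GMTL A public
  open LS.IsDistributiveLattice isDistributiveLattice public hiding (isEquivalence)
  open AS.IsCommutativeMonoid isCommutativeMonoid public using ()
    renaming ( assoc to ·-assoc; comm to ·-comm; ∙-cong to ·-cong
             ; identityˡ to ·-identityˡ; identityʳ to ·-identityʳ )

  lattice : Lattice 0ℓ 0ℓ
  lattice = record { isLattice = isLattice }

  open LatticeProperties lattice public using (∧-idem; ∨-idem)

  setoid : Setoid 0ℓ 0ℓ
  setoid = record { isEquivalence = isEquivalence }

  ≤-reflexive : ∀ {x y} → x ≈ y → x ≤ y
  ≤-reflexive {x} x≈y = trans (∧-cong refl (sym x≈y)) (∧-idem x)

  ≤-refl : ∀ {x} → x ≤ x
  ≤-refl = ≤-reflexive refl

  ≤-trans : ∀ {x y z} → x ≤ y → y ≤ z → x ≤ z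
  ≤-trans {x} {y} {z} x≤y y≤z =
    trans (∧-cong (sym x≤y) refl) (trans (∧-assoc x y z) (trans (∧-cong refl y≤z) x≤y))

  ≤-antisym : ∀ {x y} → x ≤ y → y ≤ x → x ≈ y
  ≤-antisym x≤y y≤x = trans (sym x≤y) (trans (∧-comm _ _) y≤x)

  poset : Poset 0ℓ 0ℓ 0ℓ
  poset = record
    { isPartialOrder = record
      { isPreorder = record
        { isEquivalence = isEquivalence ; reflexive = ≤-reflexive ; trans = ≤-trans }
      ; antisym = ≤-antisym } }

  open PosetReasoning poset public

  ≤-respˡ-≈ : ∀ {x x′ y} → x ≈ x′ → x ≤ y → x′ ≤ y
  ≤-respˡ-≈ x≈x′ x≤y = ≤-trans (≤-reflexive (sym x≈x′)) x≤y

  ≤-respʳ-≈ : ∀ {x y y′} → y ≈ y′ → x ≤ y → x ≤ y′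
  ≤-respʳ-≈ y≈y′ x≤y = ≤-trans x≤y (≤-reflexive y≈y′)

  x∧y≤x : ∀ x y → (x ∧ y) ≤ x
  x∧y≤x x y = trans (∧-comm _ _) (trans (sym (∧-assoc x x y)) (∧-cong (∧-idem x) refl))

  x∧y≤y : ∀ x y → (x ∧ y) ≤ y
  x∧y≤y x y = trans (∧-assoc x y y) (∧-cong refl (∧-idem y))

  ∧-greatest : ∀ {x y z} → z ≤ x → z ≤ y → z ≤ (x ∧ y)
  ∧-greatest {x} {y} {z} z≤x z≤y = trans (sym (∧-assoc z x y)) (trans (∧-cong z≤x refl) z≤y)

  x≤x∨y : ∀ x y → x ≤ (x ∨ y)
  x≤x∨y = ∧-absorbs-∨

  y≤x∨y : ∀ x y → y ≤ (x ∨ y)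
  y≤x∨y x y = ≤-respʳ-≈ (∨-comm y x) (x≤x∨y y x)

  ∨-least : ∀ {x y z} → x ≤ z → y ≤ z → (x ∨ y) ≤ z
  ∨-least {x} {y} {z} x≤z y≤z = trans (∧-distribʳ-∨ z x y) (∨-cong x≤z y≤z)

  ∨-mono-≤ : ∀ {x x′ y y′} → x ≤ x′ → y ≤ y′ → (x ∨ y) ≤ (x′ ∨ y′)
  ∨-mono-≤ x≤x′ y≤y′ = ∨-least (≤-trans x≤x′ (x≤x∨y _ _)) (≤-trans y≤y′ (y≤x∨y _ _))

  ≤𝟏 : ∀ {x} → x ≤ 𝟏
  ≤𝟏 = integral _

  residual : ∀ {x y z} → (x · y) ≤ z → y ≤ (x ⇒ z)
  residual = proj₁ (residuation _ _ _)

  unresidual : ∀ {x y z} → y ≤ (x ⇒ z) → (x · y) ≤ z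
  unresidual = proj₂ (residuation _ _ _)

  x·[x⇒y]≤y : ∀ x y → (x · (x ⇒ y)) ≤ y
  x·[x⇒y]≤y x y = unresidual ≤-refl

  ·-monoʳ-≤ : ∀ {x y} z → x ≤ y → (z · x) ≤ (z · y)
  ·-monoʳ-≤ z x≤y = unresidual (≤-trans x≤y (residual ≤-refl))

  ·-monoˡ-≤ : ∀ {x y} z → x ≤ y → (x · z) ≤ (y · z)
  ·-monoˡ-≤ z x≤y = ≤-respˡ-≈ (·-comm _ _) (≤-respʳ-≈ (·-comm _ _) (·-monoʳ-≤ z x≤y))

  ·-mono-≤ : ∀ {x x′ y y′} → x ≤ x′ → y ≤ y′ → (x · y) ≤ (x′ · y′)
  ·-mono-≤ x≤x′ y≤y′ = ≤-trans (·-monoˡ-≤ _ x≤x′) (·-monoʳ-≤ _ y≤y′)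

  x·y≤x : ∀ x y → (x · y) ≤ x
  x·y≤x x y = ≤-trans (·-monoʳ-≤ x ≤𝟏) (≤-reflexive (·-identityʳ x))

  x·y≤y : ∀ x y → (x · y) ≤ y
  x·y≤y x y = ≤-respˡ-≈ (·-comm y x) (x·y≤x y x)

  x·y≤x∧y : ∀ x y → (x · y) ≤ (x ∧ y)
  x·y≤x∧y x y = ∧-greatest (x·y≤x x y) (x·y≤y x y)

  y≤x⇒y : ∀ x y → y ≤ (x ⇒ y)
  y≤x⇒y x y = residual (x·y≤y x y)

  ⇒-antimonoˡ-≤ : ∀ {x x′} y → x ≤ x′ → (x′ ⇒ y) ≤ (x ⇒ y)
  ⇒-antimonoˡ-≤ y x≤x′ = residual (≤-trans (·-monoˡ-≤ _ x≤x′) (x·[x⇒y]≤y _ _))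

  ≤⇒⇒≈𝟏 : ∀ {x y} → x ≤ y → (x ⇒ y) ≈ 𝟏
  ≤⇒⇒≈𝟏 x≤y = ≤-antisym ≤𝟏 (residual (≤-respˡ-≈ (sym (·-identityʳ _)) x≤y))

  ⇒-identityˡ : ∀ x → (𝟏 ⇒ x) ≈ x
  ⇒-identityˡ x = ≤-antisym (≤-respˡ-≈ (·-identityˡ _) (x·[x⇒y]≤y 𝟏 x)) (y≤x⇒y 𝟏 x)

  ·-distribˡ-∨ : ∀ x y z → (x · (y ∨ z)) ≈ ((x · y) ∨ (x · z))
  ·-distribˡ-∨ x y z = ≤-antisym
    (unresidual (∨-least (residual (x≤x∨y _ _)) (residual (y≤x∨y _ _))))
    (∨-least (·-monoʳ-≤ x (x≤x∨y _ _)) (·-monoʳ-≤ x (y≤x∨y _ _)))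

  ·-interchange : ∀ a b c d → ((a · b) · (c · d)) ≈ ((a · c) · (b · d))
  ·-interchange a b c d = begin-equality
    (a · b) · (c · d) ≈⟨ ·-assoc a b _ ⟩
    a · (b · (c · d)) ≈⟨ ·-cong refl (sym (·-assoc b c d)) ⟩
    a · ((b · c) · d) ≈⟨ ·-cong refl (·-cong (·-comm b c) refl) ⟩
    a · ((c · b) · d) ≈⟨ ·-cong refl (·-assoc c b d) ⟩
    a · (c · (b · d)) ≈⟨ sym (·-assoc a c _) ⟩
    (a · c) · (b · d) ∎

  ⇒-curry : ∀ x y z → ((x · y) ⇒ z) ≈ (x ⇒ (y ⇒ z))
  ⇒-curry x y z = ≤-antisym
    (residual (residual (≤-respˡ-≈ (trans (·-cong (·-comm x y) refl) (·-assoc y x _))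
                                   (x·[x⇒y]≤y (x · y) z))))
    (residual (begin
      (x · y) · (x ⇒ (y ⇒ z)) ≈⟨ trans (·-cong (·-comm x y) refl) (·-assoc y x _) ⟩
      y · (x · (x ⇒ (y ⇒ z))) ≤⟨ ·-monoʳ-≤ y (x·[x⇒y]≤y x (y ⇒ z)) ⟩
      y · (y ⇒ z)             ≤⟨ x·[x⇒y]≤y y z ⟩
      z                       ∎))

  [x∧y]⇒z≤[x⇒z]∨[y⇒z] : ∀ x y z → ((x ∧ y) ⇒ z) ≤ ((x ⇒ z) ∨ (y ⇒ z))
  [x∧y]⇒z≤[x⇒z]∨[y⇒z] x y z = begin
      w                              ≈⟨ sym (·-identityʳ w) ⟩
      w · 𝟏                          ≈⟨ ·-cong refl (sym (prelinear x y)) ⟩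
      w · ((x ⇒ y) ∨ (y ⇒ x))        ≈⟨ ·-distribˡ-∨ _ _ _ ⟩
      (w · (x ⇒ y)) ∨ (w · (y ⇒ x))  ≤⟨ ∨-mono-≤ (case x y) (≤-trans (·-monoˡ-≤ _ y∧x≤x∧y) (case y x)) ⟩
      (x ⇒ z) ∨ (y ⇒ z)              ∎
    where
      w = (x ∧ y) ⇒ z
      y∧x≤x∧y : w ≤ ((y ∧ x) ⇒ z)
      y∧x≤x∧y = ⇒-antimonoˡ-≤ z (≤-reflexive (∧-comm y x))
      -- a · (a ⇒ b) ≤ a ∧ b, so a can stand in for a ∧ b
      case : ∀ a b → (((a ∧ b) ⇒ z) · (a ⇒ b)) ≤ (a ⇒ z)
      case a b = residual (begin
        a · (((a ∧ b) ⇒ z) · (a ⇒ b)) ≈⟨ trans (·-cong refl (·-comm _ _)) (sym (·-assoc _ _ _)) ⟩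
        (a · (a ⇒ b)) · ((a ∧ b) ⇒ z) ≤⟨ ·-monoˡ-≤ _ (∧-greatest (x·y≤x _ _) (x·[x⇒y]≤y a b)) ⟩
        (a ∧ b) · ((a ∧ b) ⇒ z)       ≤⟨ x·[x⇒y]≤y _ _ ⟩
        z                             ∎)

module MTLProperties (M : MTL) where
  open MTL M using (𝟎; bottom; ∼_) public
  open GMTLProperties (MTL.gmtl M) public

  ≤𝟎⇒≈𝟎 : ∀ {x} → x ≤ 𝟎 → x ≈ 𝟎
  ≤𝟎⇒≈𝟎 x≤𝟎 = ≤-antisym x≤𝟎 (bottom _)

  ∼-cong : ∀ {x y} → x ≈ y → (∼ x) ≈ (∼ y)
  ∼-cong x≈y = ⇒-cong x≈y refl

  ∼-antimono-≤ : ∀ {x y} → x ≤ y → (∼ y) ≤ (∼ x)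
  ∼-antimono-≤ = ⇒-antimonoˡ-≤ 𝟎

  x≤∼∼x : ∀ x → x ≤ (∼ (∼ x))
  x≤∼∼x x = residual (≤-respˡ-≈ (·-comm _ _) (x·[x⇒y]≤y x 𝟎))

  ∼∼∼x≈∼x : ∀ x → (∼ (∼ (∼ x))) ≈ (∼ x)
  ∼∼∼x≈∼x x = ≤-antisym (∼-antimono-≤ (x≤∼∼x x)) (x≤∼∼x (∼ x))

  x·∼x≈𝟎 : ∀ x → (x · (∼ x)) ≈ 𝟎
  x·∼x≈𝟎 x = ≤𝟎⇒≈𝟎 (x·[x⇒y]≤y x 𝟎)

  ∼𝟎≈𝟏 : (∼ 𝟎) ≈ 𝟏
  ∼𝟎≈𝟏 = ≤⇒⇒≈𝟏 (bottom 𝟎)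

  ⇒-zeroˡ : ∀ x → (𝟎 ⇒ x) ≈ 𝟏
  ⇒-zeroˡ x = ≤⇒⇒≈𝟏 (bottom x)

  ·-zeroˡ : ∀ x → (𝟎 · x) ≈ 𝟎
  ·-zeroˡ x = ≤𝟎⇒≈𝟎 (x·y≤x 𝟎 x)

  ·-zeroʳ : ∀ x → (x · 𝟎) ≈ 𝟎
  ·-zeroʳ x = ≤𝟎⇒≈𝟎 (x·y≤y x 𝟎)

  ∧-zeroʳ : ∀ x → (x ∧ 𝟎) ≈ 𝟎
  ∧-zeroʳ x = ≤𝟎⇒≈𝟎 (x∧y≤y x 𝟎)

  ∨-identityˡ : ∀ x → (𝟎 ∨ x) ≈ x
  ∨-identityˡ x = ≤-antisym (∨-least (bottom x) ≤-refl) (y≤x∨y 𝟎 x)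

  ∨-identityʳ : ∀ x → (x ∨ 𝟎) ≈ x
  ∨-identityʳ x = trans (∨-comm x 𝟎) (∨-identityˡ x)

  𝟎≈𝟏⇒trivial : 𝟎 ≈ 𝟏 → Trivial M
  𝟎≈𝟏⇒trivial 𝟎≈𝟏 x y = trans (≈𝟎 x) (sym (≈𝟎 y))
    where
      ≈𝟎 : ∀ x → x ≈ 𝟎
      ≈𝟎 x = ≤𝟎⇒≈𝟎 (≤-respʳ-≈ (sym 𝟎≈𝟏) ≤𝟏)

  Dense : Carrier → Set
  Dense x = (∼ x) ≈ 𝟎

  dense-resp-≈ : ∀ {x y} → x ≈ y → Dense x → Dense y
  dense-resp-≈ x≈y dx = trans (∼-cong (sym x≈y)) dx

  dense-𝟏 : Dense 𝟏
  dense-𝟏 = ⇒-identityˡ 𝟎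

  dense-∧ : ∀ {x y} → Dense x → Dense y → Dense (x ∧ y)
  dense-∧ {x} {y} dx dy = ≤𝟎⇒≈𝟎 (≤-respʳ-≈ (trans (∨-cong dx dy) (∨-idem 𝟎)) ([x∧y]⇒z≤[x⇒z]∨[y⇒z] x y 𝟎))

  dense-∨ : ∀ {x y} → Dense x → Dense y → Dense (x ∨ y)
  dense-∨ dx _ = ≤𝟎⇒≈𝟎 (≤-respʳ-≈ dx (∼-antimono-≤ (x≤x∨y _ _)))

  dense-· : ∀ {x y} → Dense x → Dense y → Dense (x · y)
  dense-· {x} {y} dx dy = trans (⇒-curry x y 𝟎) (trans (⇒-cong refl dy) dx)

  dense-⇒ : ∀ {x y} → Dense x → Dense y → Dense (x ⇒ y)
  dense-⇒ {x} {y} _ dy = ≤𝟎⇒≈𝟎 (≤-respʳ-≈ dy (∼-antimono-≤ (y≤x⇒y x y)))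

  Complementary : Carrier → Carrier → Set
  Complementary e f = ((e ∨ f) ≈ 𝟏) × ((e ∧ f) ≈ 𝟎)

  complementary-sym : ∀ {e f} → Complementary e f → Complementary f e
  complementary-sym (e∨f≈𝟏 , e∧f≈𝟎) = trans (∨-comm _ _) e∨f≈𝟏 , trans (∧-comm _ _) e∧f≈𝟎

  nontrivial⇒𝟎-not-dense : Nontrivial M → ∀ {x} → x ≈ 𝟎 → ¬ Dense x
  nontrivial⇒𝟎-not-dense 𝟎≉𝟏 x≈𝟎 dx = 𝟎≉𝟏 (sym (trans (sym ∼𝟎≈𝟏) (dense-resp-≈ x≈𝟎 dx)))

ZeroOrDense : MTL → Set
ZeroOrDense M = ∀ x → x ≈ 𝟎 ⊎ Dense x
  where open MTLProperties M

Closed₂ : {X : Set} → (X → Set) → Op₂ X → Set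
Closed₂ P _∙_ = ∀ {x y} → P x → P y → P (x ∙ y)

module Subalgebra (A : GMTL) (P : GMTL.Carrier A → Set) (𝟏-closed : P (GMTL.𝟏 A))
  (∧-closed : Closed₂ P (GMTL._∧_ A)) (∨-closed : Closed₂ P (GMTL._∨_ A))
  (·-closed : Closed₂ P (GMTL._·_ A)) (⇒-closed : Closed₂ P (GMTL._⇒_ A)) where
  open GMTLProperties A

  _≈ₚ_ : Rel (Σ Carrier P) 0ℓ
  (x , _) ≈ₚ (y , _) = x ≈ y

  infix 4 _≈ₚ_

  lift₂ : (_∙_ : Op₂ Carrier) → Closed₂ P _∙_ → Op₂ (Σ Carrier P)
  lift₂ _∙_ closed (x , px) (y , py) = (x ∙ y) , closed px py

  gmtl : GMTL
  gmtl = record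
    { Carrier = Σ Carrier P
    ; _≈_ = _≈ₚ_
    ; _∧_ = lift₂ _∧_ ∧-closed
    ; _∨_ = lift₂ _∨_ ∨-closed
    ; _·_ = lift₂ _·_ ·-closed
    ; _⇒_ = lift₂ _⇒_ ⇒-closed
    ; 𝟏 = 𝟏 , 𝟏-closed
    ; isGMTL = record
      { isDistributiveLattice = record
        { isLattice = record
          { isEquivalence = isEquivalence′
          ; ∨-comm = λ x y → ∨-comm (proj₁ x) (proj₁ y)
          ; ∨-assoc = λ x y z → ∨-assoc (proj₁ x) (proj₁ y) (proj₁ z)
          ; ∨-cong = ∨-cong
          ; ∧-comm = λ x y → ∧-comm (proj₁ x) (proj₁ y)
          ; ∧-assoc = λ x y z → ∧-assoc (proj₁ x) (proj₁ y) (proj₁ z)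
          ; ∧-cong = ∧-cong
          ; absorptive = (λ x y → ∨-absorbs-∧ (proj₁ x) (proj₁ y))
                       , (λ x y → ∧-absorbs-∨ (proj₁ x) (proj₁ y)) }
        ; ∨-distrib-∧ = (λ x y z → ∨-distribˡ-∧ (proj₁ x) (proj₁ y) (proj₁ z))
                      , (λ x y z → ∨-distribʳ-∧ (proj₁ x) (proj₁ y) (proj₁ z))
        ; ∧-distrib-∨ = (λ x y z → ∧-distribˡ-∨ (proj₁ x) (proj₁ y) (proj₁ z))
                      , (λ x y z → ∧-distribʳ-∨ (proj₁ x) (proj₁ y) (proj₁ z)) }
      ; isCommutativeMonoid = record
        { isMonoid = record
          { isSemigroup = record
            { isMagma = record { isEquivalence = isEquivalence′ ; ∙-cong = ·-cong }
            ; assoc = λ x y z → ·-assoc (proj₁ x) (proj₁ y) (proj₁ z) }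
          ; identity = (λ x → ·-identityˡ (proj₁ x)) , (λ x → ·-identityʳ (proj₁ x)) }
        ; comm = λ x y → ·-comm (proj₁ x) (proj₁ y) }
      ; ⇒-cong = ⇒-cong
      ; integral = λ x → integral (proj₁ x)
      ; residuation = λ x y z → residuation (proj₁ x) (proj₁ y) (proj₁ z)
      ; prelinear = λ x y → prelinear (proj₁ x) (proj₁ y) } }
    where
      isEquivalence′ : IsEquivalence _≈ₚ_
      isEquivalence′ = record { refl = refl ; sym = sym ; trans = trans }

DenseSubalgebra : MTL → GMTL
DenseSubalgebra M = Subalgebra.gmtl (MTL.gmtl M) Dense dense-𝟏 dense-∧ dense-∨ dense-· dense-⇒
  where open MTLProperties M

module _ {A : Set} {_≈_ : Rel A 0ℓ} {_∙_ : Op₂ A} where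
  private
    _≈′_ = Pointwise _≈_

  zipWith-cong : (∀ {a a′ b b′} → a ≈ a′ → b ≈ b′ → (a ∙ b) ≈ (a′ ∙ b′)) →
                 ∀ {x x′ y y′} → x ≈′ x′ → y ≈′ y′ → zipWith _∙_ x y ≈′ zipWith _∙_ x′ y′
  zipWith-cong ∙-cong nothing  _        = nothing
  zipWith-cong ∙-cong (just p) nothing  = nothing
  zipWith-cong ∙-cong (just p) (just q) = just (∙-cong p q)

  zipWith-comm : (∀ a b → (a ∙ b) ≈ (b ∙ a)) → ∀ x y → zipWith _∙_ x y ≈′ zipWith _∙_ y x
  zipWith-comm ∙-comm nothing  nothing  = nothing
  zipWith-comm ∙-comm nothing  (just b) = nothing
  zipWith-comm ∙-comm (just a) nothing  = nothing
  zipWith-comm ∙-comm (just a) (just b) = just (∙-comm a b)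

  zipWith-assoc : (∀ a b c → ((a ∙ b) ∙ c) ≈ (a ∙ (b ∙ c))) →
                  ∀ x y z → zipWith _∙_ (zipWith _∙_ x y) z ≈′ zipWith _∙_ x (zipWith _∙_ y z)
  zipWith-assoc ∙-assoc nothing  _        _        = nothing
  zipWith-assoc ∙-assoc (just a) nothing  _        = nothing
  zipWith-assoc ∙-assoc (just a) (just b) nothing  = nothing
  zipWith-assoc ∙-assoc (just a) (just b) (just c) = just (∙-assoc a b c)

-- 𝟐 ⊕ B: nothing is a new least element below all of B.
module AdjoinBottom (B : GMTL) where
  open GMTLProperties B

  infix 4 _≈′_
  _≈′_ : Rel (Maybe Carrier) 0ℓ
  _≈′_ = Pointwise _≈_

  ≈′-isEquivalence : IsEquivalence _≈′_
  ≈′-isEquivalence = Pointwise.isEquivalence isEquivalence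

  open IsEquivalence ≈′-isEquivalence using () renaming (refl to ≈′-refl)

  _∧′_ _·′_ _∨′_ _⇒′_ : Op₂ (Maybe Carrier)
  _∧′_ = zipWith _∧_
  _·′_ = zipWith _·_

  nothing ∨′ y       = y
  just a  ∨′ nothing = just a
  just a  ∨′ just b  = just (a ∨ b)

  nothing ⇒′ _       = just 𝟏
  just a  ⇒′ nothing = nothing
  just a  ⇒′ just b  = just (a ⇒ b)

  ∨′-cong : ∀ {x x′ y y′} → x ≈′ x′ → y ≈′ y′ → (x ∨′ y) ≈′ (x′ ∨′ y′)
  ∨′-cong nothing  q        = q
  ∨′-cong (just p) nothing  = just p
  ∨′-cong (just p) (just q) = just (∨-cong p q)

  ∨′-comm : ∀ x y → (x ∨′ y) ≈′ (y ∨′ x)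
  ∨′-comm nothing  nothing  = nothing
  ∨′-comm nothing  (just b) = just refl
  ∨′-comm (just a) nothing  = just refl
  ∨′-comm (just a) (just b) = just (∨-comm a b)

  ∨′-assoc : ∀ x y z → ((x ∨′ y) ∨′ z) ≈′ (x ∨′ (y ∨′ z))
  ∨′-assoc nothing  y        z        = ≈′-refl
  ∨′-assoc (just a) nothing  z        = ≈′-refl
  ∨′-assoc (just a) (just b) nothing  = just refl
  ∨′-assoc (just a) (just b) (just c) = just (∨-assoc a b c)

  ⇒′-cong : ∀ {x x′ y y′} → x ≈′ x′ → y ≈′ y′ → (x ⇒′ y) ≈′ (x′ ⇒′ y′)
  ⇒′-cong nothing  _        = just refl
  ⇒′-cong (just p) nothing  = nothing
  ⇒′-cong (just p) (just q) = just (⇒-cong p q)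

  ∨′-absorbs-∧′ : ∀ x y → (x ∨′ (x ∧′ y)) ≈′ x
  ∨′-absorbs-∧′ nothing  y        = nothing
  ∨′-absorbs-∧′ (just a) nothing  = just refl
  ∨′-absorbs-∧′ (just a) (just b) = just (∨-absorbs-∧ a b)

  ∧′-absorbs-∨′ : ∀ x y → (x ∧′ (x ∨′ y)) ≈′ x
  ∧′-absorbs-∨′ nothing  y        = nothing
  ∧′-absorbs-∨′ (just a) nothing  = just (∧-idem a)
  ∧′-absorbs-∨′ (just a) (just b) = just (∧-absorbs-∨ a b)

  ∨′-distribˡ-∧′ : ∀ x y z → (x ∨′ (y ∧′ z)) ≈′ ((x ∨′ y) ∧′ (x ∨′ z))
  ∨′-distribˡ-∧′ nothing  y        z        = ≈′-refl
  ∨′-distribˡ-∧′ (just a) nothing  nothing  = just (sym (∧-idem a))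
  ∨′-distribˡ-∧′ (just a) nothing  (just c) = just (sym (∧-absorbs-∨ a c))
  ∨′-distribˡ-∧′ (just a) (just b) nothing  = just (sym (trans (∧-comm _ _) (∧-absorbs-∨ a b)))
  ∨′-distribˡ-∧′ (just a) (just b) (just c) = just (∨-distribˡ-∧ a b c)

  ∧′-distribˡ-∨′ : ∀ x y z → (x ∧′ (y ∨′ z)) ≈′ ((x ∧′ y) ∨′ (x ∧′ z))
  ∧′-distribˡ-∨′ nothing  y        z        = nothing
  ∧′-distribˡ-∨′ (just a) nothing  z        = ≈′-refl
  ∧′-distribˡ-∨′ (just a) (just b) nothing  = just refl
  ∧′-distribˡ-∨′ (just a) (just b) (just c) = just (∧-distribˡ-∨ a b c)

  infix 4 _≤′_
  _≤′_ : Rel (Maybe Carrier) 0ℓ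
  x ≤′ y = (x ∧′ y) ≈′ x

  ≤′𝟏 : ∀ x → x ≤′ just 𝟏
  ≤′𝟏 nothing  = nothing
  ≤′𝟏 (just a) = just (integral a)

  residuation′ : ∀ x y z → ((x ·′ y) ≤′ z → y ≤′ (x ⇒′ z)) × (y ≤′ (x ⇒′ z) → (x ·′ y) ≤′ z)
  residuation′ nothing  y        z        = (λ _ → ≤′𝟏 y) , (λ _ → nothing)
  residuation′ (just a) nothing  z        = (λ _ → nothing) , (λ _ → nothing)
  residuation′ (just a) (just b) nothing  = (λ ()) , (λ ())
  residuation′ (just a) (just b) (just c) =
    (λ p → just (residual (Pointwise.drop-just p))) , (λ p → just (unresidual (Pointwise.drop-just p)))

  prelinear′ : ∀ x y → ((x ⇒′ y) ∨′ (y ⇒′ x)) ≈′ just 𝟏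
  prelinear′ nothing  nothing  = just (∨-idem 𝟏)
  prelinear′ nothing  (just b) = just refl
  prelinear′ (just a) nothing  = just refl
  prelinear′ (just a) (just b) = just (prelinear a b)

  gmtl : GMTL
  gmtl = record
    { Carrier = Maybe Carrier
    ; _≈_ = _≈′_
    ; _∧_ = _∧′_
    ; _∨_ = _∨′_
    ; _·_ = _·′_
    ; _⇒_ = _⇒′_
    ; 𝟏 = just 𝟏
    ; isGMTL = record
      { isDistributiveLattice = record
        { isLattice = record
          { isEquivalence = ≈′-isEquivalence
          ; ∨-comm = ∨′-comm
          ; ∨-assoc = ∨′-assoc
          ; ∨-cong = ∨′-cong
          ; ∧-comm = zipWith-comm ∧-comm
          ; ∧-assoc = zipWith-assoc ∧-assoc
          ; ∧-cong = zipWith-cong ∧-cong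
          ; absorptive = ∨′-absorbs-∧′ , ∧′-absorbs-∨′ }
        ; ∨-distrib-∧ = comm∧distrˡ⇒distr setoid′ (zipWith-cong ∧-cong) ∨′-comm ∨′-distribˡ-∧′
        ; ∧-distrib-∨ = comm∧distrˡ⇒distr setoid′ ∨′-cong (zipWith-comm ∧-comm) ∧′-distribˡ-∨′ }
      ; isCommutativeMonoid = record
        { isMonoid = record
          { isSemigroup = record
            { isMagma = record { isEquivalence = ≈′-isEquivalence ; ∙-cong = zipWith-cong ·-cong }
            ; assoc = zipWith-assoc ·-assoc }
          ; identity = ·′-identityˡ , ·′-identityʳ }
        ; comm = zipWith-comm ·-comm }
      ; ⇒-cong = ⇒′-cong
      ; integral = ≤′𝟏
      ; residuation = residuation′
      ; prelinear = prelinear′ } }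
    where
      setoid′ : Setoid 0ℓ 0ℓ
      setoid′ = Pointwise.setoid setoid
      ·′-identityˡ : ∀ x → (just 𝟏 ·′ x) ≈′ x
      ·′-identityˡ nothing  = nothing
      ·′-identityˡ (just a) = just (·-identityˡ a)
      ·′-identityʳ : ∀ x → (x ·′ just 𝟏) ≈′ x
      ·′-identityʳ nothing  = nothing
      ·′-identityʳ (just a) = just (·-identityʳ a)

  mtl : MTL
  mtl = record { gmtl = gmtl ; 𝟎 = nothing ; bottom = λ _ → nothing }

  smtl : SMTL
  smtl = record { mtl = mtl ; pseudocomplement = pseudocomplement′ }
    where
      pseudocomplement′ : ∀ x → (x ∧′ (x ⇒′ nothing)) ≈′ nothing
      pseudocomplement′ nothing  = nothing
      pseudocomplement′ (just a) = nothing

module _ {A B : GMTL} (f : GMTLHom A B) where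
  private
    module A = AdjoinBottom A
    module B = AdjoinBottom B
    open GMTLProperties B using (refl)
    open GMTLHom f

  adjoinBottom-map : Maybe (GMTL.Carrier A) → Maybe (GMTL.Carrier B)
  adjoinBottom-map nothing  = nothing
  adjoinBottom-map (just a) = just ⟦ a ⟧

  adjoinBottom-hom : MTLHom A.mtl B.mtl
  adjoinBottom-hom = record
    { hom = record
      { ⟦_⟧ = adjoinBottom-map
      ; cong = λ { nothing → nothing ; (just p) → just (cong p) }
      ; pres-∧ = pres-strict pres-∧
      ; pres-∨ = pres-∨′
      ; pres-· = pres-strict pres-·
      ; pres-⇒ = pres-⇒′
      ; pres-𝟏 = just pres-𝟏 }
    ; pres-𝟎 = nothing }
    where
      pres-strict : ∀ {_∙_ _∘_} → (∀ a b → GMTL._≈_ B ⟦ a ∙ b ⟧ (⟦ a ⟧ ∘ ⟦ b ⟧)) → ∀ x y →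
                    adjoinBottom-map (zipWith _∙_ x y) B.≈′ zipWith _∘_ (adjoinBottom-map x) (adjoinBottom-map y)
      pres-strict p nothing  y        = nothing
      pres-strict p (just a) nothing  = nothing
      pres-strict p (just a) (just b) = just (p a b)
      pres-∨′ : ∀ x y → adjoinBottom-map (x A.∨′ y) B.≈′ (adjoinBottom-map x B.∨′ adjoinBottom-map y)
      pres-∨′ nothing  y        = Pointwise.refl refl
      pres-∨′ (just a) nothing  = just refl
      pres-∨′ (just a) (just b) = just (pres-∨ a b)
      pres-⇒′ : ∀ x y → adjoinBottom-map (x A.⇒′ y) B.≈′ (adjoinBottom-map x B.⇒′ adjoinBottom-map y)
      pres-⇒′ nothing  y        = just pres-𝟏
      pres-⇒′ (just a) nothing  = nothing
      pres-⇒′ (just a) (just b) = just (pres-⇒ a b)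

module _ {A B : MTL} (h : MTLHom A B) where
  private
    module A = MTLProperties A
    module B = MTLProperties B
    open MTLHom h

  hom-pres-dense : ∀ {x} → A.Dense x → B.Dense ⟦ x ⟧
  hom-pres-dense {x} dx = B.begin-equality
    ⟦ x ⟧ B.⇒ B.𝟎     B.≈⟨ B.⇒-cong B.refl (B.sym pres-𝟎) ⟩
    ⟦ x ⟧ B.⇒ ⟦ A.𝟎 ⟧ B.≈⟨ B.sym (pres-⇒ x A.𝟎) ⟩
    ⟦ A.∼ x ⟧         B.≈⟨ cong dx ⟩
    ⟦ A.𝟎 ⟧           B.≈⟨ pres-𝟎 ⟩
    B.𝟎               B.∎

  dense-hom : GMTLHom (DenseSubalgebra A) (DenseSubalgebra B)
  dense-hom = record
    { ⟦_⟧ = λ (x , dx) → ⟦ x ⟧ , hom-pres-dense dx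
    ; cong = cong
    ; pres-∧ = λ x y → pres-∧ (proj₁ x) (proj₁ y)
    ; pres-∨ = λ x y → pres-∨ (proj₁ x) (proj₁ y)
    ; pres-· = λ x y → pres-· (proj₁ x) (proj₁ y)
    ; pres-⇒ = λ x y → pres-⇒ (proj₁ x) (proj₁ y)
    ; pres-𝟏 = pres-𝟏 }

module _ {A B : GMTL} (f : GMTLHom A B) (g : GMTL.Carrier B → GMTL.Carrier A)
         (g-cong : ∀ {x y} → GMTL._≈_ B x y → GMTL._≈_ A (g x) (g y))
         (f∘g≈id : ∀ b → GMTL._≈_ B (GMTLHom.⟦_⟧ f (g b)) b)
         (g∘f≈id : ∀ a → GMTL._≈_ A (g (GMTLHom.⟦_⟧ f a)) a) where
  private
    module A = GMTLProperties A
    module B = GMTLProperties B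
    open GMTLHom f

  inverse-pres₂ : (_∙_ : Op₂ A.Carrier) (_∘_ : Op₂ B.Carrier) → (∀ {a a′ b b′} → a B.≈ a′ → b B.≈ b′ → (a ∘ b) B.≈ (a′ ∘ b′)) →
                  (∀ a b → ⟦ a ∙ b ⟧ B.≈ (⟦ a ⟧ ∘ ⟦ b ⟧)) → ∀ x y → g (x ∘ y) A.≈ (g x ∙ g y)
  inverse-pres₂ _∙_ _∘_ ∘-cong pres x y = A.begin-equality
    g (x ∘ y)                 A.≈⟨ g-cong (∘-cong (B.sym (f∘g≈id x)) (B.sym (f∘g≈id y))) ⟩
    g (⟦ g x ⟧ ∘ ⟦ g y ⟧)     A.≈⟨ g-cong (B.sym (pres (g x) (g y))) ⟩
    g ⟦ g x ∙ g y ⟧           A.≈⟨ g∘f≈id _ ⟩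
    g x ∙ g y                 A.∎

  inverse-hom : GMTLHom B A
  inverse-hom = record
    { ⟦_⟧ = g
    ; cong = g-cong
    ; pres-∧ = inverse-pres₂ A._∧_ B._∧_ B.∧-cong pres-∧
    ; pres-∨ = inverse-pres₂ A._∨_ B._∨_ B.∨-cong pres-∨
    ; pres-· = inverse-pres₂ A._·_ B._·_ B.·-cong pres-·
    ; pres-⇒ = inverse-pres₂ A._⇒_ B._⇒_ B.⇒-cong pres-⇒
    ; pres-𝟏 = A.trans (g-cong (B.sym pres-𝟏)) (g∘f≈id _) }

module _ {A B : MTL} (h : MTLHom A B) (g : MTL.Carrier B → MTL.Carrier A)
         (g-cong : ∀ {x y} → MTL._≈_ B x y → MTL._≈_ A (g x) (g y))
         (h∘g≈id : ∀ b → MTL._≈_ B (MTLHom.⟦_⟧ h (g b)) b)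
         (g∘h≈id : ∀ a → MTL._≈_ A (g (MTLHom.⟦_⟧ h a)) a) where

  inverse-mtlHom : MTLHom B A
  inverse-mtlHom = record
    { hom = inverse-hom (MTLHom.hom h) g g-cong h∘g≈id g∘h≈id
    ; pres-𝟎 = A.trans (g-cong (B.sym (MTLHom.pres-𝟎 h))) (g∘h≈id _) }
    where
      module A = MTLProperties A
      module B = MTLProperties B

module _ (B : GMTL) where
  private
    open AdjoinBottom B
    open GMTLProperties B using (_≈_; refl)
    B⁺ = DenseSubalgebra mtl

  η-hom : GMTLHom B B⁺
  η-hom = record
    { ⟦_⟧ = λ b → just b , nothing
    ; cong = just
    ; pres-∧ = λ _ _ → just refl
    ; pres-∨ = λ _ _ → just refl
    ; pres-· = λ _ _ → just refl
    ; pres-⇒ = λ _ _ → just refl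
    ; pres-𝟏 = just refl }

  η⁻¹ : GMTL.Carrier B⁺ → GMTL.Carrier B
  η⁻¹ (just b , _) = b

  η⁻¹-cong : ∀ {x y} → GMTL._≈_ B⁺ x y → η⁻¹ x ≈ η⁻¹ y
  η⁻¹-cong {just _ , _} {just _ , _} (just p) = p

  η∘η⁻¹≈id : ∀ x → GMTL._≈_ B⁺ (GMTLHom.⟦_⟧ η-hom (η⁻¹ x)) x
  η∘η⁻¹≈id (just b , _) = just refl

  η⁻¹-hom : GMTLHom B⁺ B
  η⁻¹-hom = inverse-hom η-hom η⁻¹ η⁻¹-cong η∘η⁻¹≈id (λ _ → refl)

module _ (M : MTL) where
  private
    open MTLProperties M
    module M⁻ = AdjoinBottom (DenseSubalgebra M)

  ε : Maybe (Σ Carrier Dense) → Carrier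
  ε nothing        = 𝟎
  ε (just (x , _)) = x

  ε-hom : MTLHom M⁻.mtl M
  ε-hom = record
    { hom = record
      { ⟦_⟧ = ε
      ; cong = λ { nothing → refl ; (just p) → p }
      ; pres-∧ = pres-∧
      ; pres-∨ = pres-∨
      ; pres-· = pres-·
      ; pres-⇒ = pres-⇒
      ; pres-𝟏 = refl }
    ; pres-𝟎 = refl }
    where
      open M⁻ using (_∧′_; _∨′_; _·′_; _⇒′_)
      pres-∧ : ∀ x y → ε (x ∧′ y) ≈ (ε x ∧ ε y)
      pres-∧ nothing  y        = sym (bottom _)
      pres-∧ (just a) nothing  = sym (∧-zeroʳ _)
      pres-∧ (just a) (just b) = refl
      pres-· : ∀ x y → ε (x ·′ y) ≈ (ε x · ε y)
      pres-· nothing  y        = sym (·-zeroˡ _)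
      pres-· (just a) nothing  = sym (·-zeroʳ _)
      pres-· (just a) (just b) = refl
      pres-∨ : ∀ x y → ε (x ∨′ y) ≈ (ε x ∨ ε y)
      pres-∨ nothing  y        = sym (∨-identityˡ _)
      pres-∨ (just a) nothing  = sym (∨-identityʳ _)
      pres-∨ (just a) (just b) = refl
      pres-⇒ : ∀ x y → ε (x ⇒′ y) ≈ (ε x ⇒ ε y)
      pres-⇒ nothing         y        = sym (⇒-zeroˡ _)
      pres-⇒ (just (a , da)) nothing  = sym da
      pres-⇒ (just a)        (just b) = refl

ε-natural : ∀ {M M′} (h : MTLHom M M′) z →
            MTL._≈_ M′ (ε M′ (adjoinBottom-map (dense-hom h) z)) (MTLHom.⟦_⟧ h (ε M z))
ε-natural {M′ = M′} h nothing  = MTLProperties.sym M′ (MTLHom.pres-𝟎 h)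
ε-natural {M′ = M′} h (just _) = MTLProperties.refl M′

module _ (M : MTL) (nontrivial : Nontrivial M) (zero-or-dense : ZeroOrDense M) where
  private
    open MTLProperties M
    module M⁻ = AdjoinBottom (DenseSubalgebra M)
    𝟎-not-dense : ∀ {x} → x ≈ 𝟎 → ¬ Dense x
    𝟎-not-dense = nontrivial⇒𝟎-not-dense nontrivial

  ε⁻¹-by : ∀ x → x ≈ 𝟎 ⊎ Dense x → Maybe (Σ Carrier Dense)
  ε⁻¹-by x (inj₁ _)  = nothing
  ε⁻¹-by x (inj₂ dx) = just (x , dx)

  ε⁻¹ : Carrier → Maybe (Σ Carrier Dense)
  ε⁻¹ x = ε⁻¹-by x (zero-or-dense x)

  ε⁻¹-by-cong : ∀ {x y} (s : x ≈ 𝟎 ⊎ Dense x) (t : y ≈ 𝟎 ⊎ Dense y) → x ≈ y → ε⁻¹-by x s M⁻.≈′ ε⁻¹-by y t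
  ε⁻¹-by-cong (inj₁ _)   (inj₁ _)   _   = nothing
  ε⁻¹-by-cong (inj₁ x≈𝟎) (inj₂ dy)  x≈y = ⊥-elim (𝟎-not-dense (trans (sym x≈y) x≈𝟎) dy)
  ε⁻¹-by-cong (inj₂ dx)  (inj₁ y≈𝟎) x≈y = ⊥-elim (𝟎-not-dense (trans x≈y y≈𝟎) dx)
  ε⁻¹-by-cong (inj₂ _)   (inj₂ _)   x≈y = just x≈y

  ε∘ε⁻¹-by≈id : ∀ x (s : x ≈ 𝟎 ⊎ Dense x) → ε M (ε⁻¹-by x s) ≈ x
  ε∘ε⁻¹-by≈id x (inj₁ x≈𝟎) = sym x≈𝟎
  ε∘ε⁻¹-by≈id x (inj₂ _)   = refl

  ε⁻¹-by∘ε≈id : ∀ z (s : ε M z ≈ 𝟎 ⊎ Dense (ε M z)) → ε⁻¹-by (ε M z) s M⁻.≈′ z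
  ε⁻¹-by∘ε≈id nothing         (inj₁ _)   = nothing
  ε⁻¹-by∘ε≈id nothing         (inj₂ d𝟎)  = ⊥-elim (𝟎-not-dense refl d𝟎)
  ε⁻¹-by∘ε≈id (just (x , dx)) (inj₁ x≈𝟎) = ⊥-elim (𝟎-not-dense x≈𝟎 dx)
  ε⁻¹-by∘ε≈id (just (x , dx)) (inj₂ _)   = just refl

  ε∘ε⁻¹≈id : ∀ x → ε M (ε⁻¹ x) ≈ x
  ε∘ε⁻¹≈id x = ε∘ε⁻¹-by≈id x (zero-or-dense x)

  ε⁻¹∘ε≈id : ∀ z → ε⁻¹ (ε M z) M⁻.≈′ z
  ε⁻¹∘ε≈id z = ε⁻¹-by∘ε≈id z (zero-or-dense (ε M z))

  ε⁻¹-hom : MTLHom M M⁻.mtl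
  ε⁻¹-hom = inverse-mtlHom (ε-hom M) ε⁻¹
    (λ {x} {y} → ε⁻¹-by-cong (zero-or-dense x) (zero-or-dense y)) ε∘ε⁻¹≈id ε⁻¹∘ε≈id

noZeroDivisors⇒zeroOrDense : ∀ M → NoZeroDivisors M → ZeroOrDense M
noZeroDivisors⇒zeroOrDense M (_ , no-zero-divisors) x = no-zero-divisors x (∼ x) (x·∼x≈𝟎 x)
  where open MTLProperties M

adjoinBottom-noZeroDivisors : ∀ B → NoZeroDivisors (AdjoinBottom.mtl B)
adjoinBottom-noZeroDivisors B = (λ ()) , no-zero-divisors
  where
    open AdjoinBottom B
    no-zero-divisors : ∀ x y → (x ·′ y) ≈′ nothing → x ≈′ nothing ⊎ y ≈′ nothing
    no-zero-divisors nothing  _        _ = inj₁ nothing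
    no-zero-divisors (just _) nothing  _ = inj₂ nothing
    no-zero-divisors (just _) (just _) ()

adjoinBottom-zeroOrDense : ∀ B → ZeroOrDense (AdjoinBottom.mtl B)
adjoinBottom-zeroOrDense B nothing  = inj₁ nothing
adjoinBottom-zeroOrDense B (just _) = inj₂ nothing

-- In a product B × C the element (𝟏 , 𝟎) is neither 𝟎 nor dense unless a factor is trivial.
zeroOrDense⇒directlyIndecomposable : ∀ S → Nontrivial (SMTL.mtl S) → ZeroOrDense (SMTL.mtl S) →
                                     DirectlyIndecomposable S
zeroOrDense⇒directlyIndecomposable S nontrivial zero-or-dense = nontrivial , indecomposable
  where
    module A = MTLProperties (SMTL.mtl S)
    indecomposable : ∀ B C → IsoToProduct (SMTL.mtl S) (SMTL.mtl B) (SMTL.mtl C) →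
                     Trivial (SMTL.mtl B) ⊎ Trivial (SMTL.mtl C)
    indecomposable B C (p , q , g , _ , p∘g≈proj₁ , q∘g≈proj₂ , _)
      with zero-or-dense (g (SMTL.𝟏 B) (SMTL.𝟎 C))
    ... | inj₁ u≈𝟎 = inj₁ (B.𝟎≈𝟏⇒trivial (B.begin-equality
            B.𝟎                     B.≈⟨ B.sym (MTLHom.pres-𝟎 p) ⟩
            p.⟦ A.𝟎 ⟧               B.≈⟨ MTLHom.cong p (A.sym u≈𝟎) ⟩
            p.⟦ g B.𝟏 (SMTL.𝟎 C) ⟧  B.≈⟨ p∘g≈proj₁ _ _ ⟩
            B.𝟏                     B.∎))
      where
        module B = MTLProperties (SMTL.mtl B)
        module p = MTLHom p
    ... | inj₂ u-dense = inj₂ (C.𝟎≈𝟏⇒trivial (C.begin-equality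
            C.𝟎                    C.≈⟨ C.sym (MTLHom.pres-𝟎 q) ⟩
            q.⟦ A.𝟎 ⟧              C.≈⟨ MTLHom.cong q (A.sym u-dense) ⟩
            q.⟦ A.∼ u ⟧            C.≈⟨ MTLHom.pres-⇒ q _ _ ⟩
            q.⟦ u ⟧ C.⇒ q.⟦ A.𝟎 ⟧  C.≈⟨ C.⇒-cong (q∘g≈proj₂ _ _) (MTLHom.pres-𝟎 q) ⟩
            C.∼ C.𝟎                C.≈⟨ C.∼𝟎≈𝟏 ⟩
            C.𝟏                    C.∎))
      where
        u = g (SMTL.𝟏 B) (SMTL.𝟎 C)
        module C = MTLProperties (SMTL.mtl C)
        module q = MTLHom q

adjoinBottom-directlyIndecomposable : ∀ B → DirectlyIndecomposable (AdjoinBottom.smtl B)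
adjoinBottom-directlyIndecomposable B = zeroOrDense⇒directlyIndecomposable (AdjoinBottom.smtl B)
  (proj₁ (adjoinBottom-noZeroDivisors B)) (adjoinBottom-zeroOrDense B)

-- The direct factor of M cut out by a complementary pair e, f (isomorphic to the interval [𝟎, e]).
module Factor (M : MTL) {e f : MTL.Carrier M} (complementary : MTLProperties.Complementary M e f) where
  open MTLProperties M
  open Σ complementary renaming (proj₁ to e∨f≈𝟏; proj₂ to e∧f≈𝟎)

  x∧e≈e·x : ∀ x → (x ∧ e) ≈ (e · x)
  x∧e≈e·x x = ≤-antisym (begin
      x ∧ e                          ≈⟨ sym (·-identityʳ _) ⟩
      (x ∧ e) · 𝟏                    ≈⟨ ·-cong refl (sym e∨f≈𝟏) ⟩
      (x ∧ e) · (e ∨ f)              ≈⟨ ·-distribˡ-∨ _ _ _ ⟩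
      ((x ∧ e) · e) ∨ ((x ∧ e) · f)  ≤⟨ ∨-least x∧e·e≤e·x x∧e·f≤e·x ⟩
      e · x                          ∎)
    (≤-respˡ-≈ (·-comm x e) (x·y≤x∧y x e))
    where
      x∧e·e≤e·x : ((x ∧ e) · e) ≤ (e · x)
      x∧e·e≤e·x = ≤-trans (·-monoˡ-≤ e (x∧y≤x x e)) (≤-reflexive (·-comm x e))
      x∧e·f≤e·x : ((x ∧ e) · f) ≤ (e · x)
      x∧e·f≤e·x = ≤-trans (·-monoˡ-≤ f (x∧y≤y x e))
                    (≤-trans (x·y≤x∧y e f) (≤-trans (≤-reflexive e∧f≈𝟎) (bottom _)))

  e·e≈e : (e · e) ≈ e
  e·e≈e = trans (sym (x∧e≈e·x e)) (∧-idem e)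

  infix 4 _≈ₑ_
  _≈ₑ_ : Rel Carrier 0ℓ
  x ≈ₑ y = (x ∧ e) ≈ (y ∧ e)

  ≈⇒≈ₑ : ∀ {x y} → x ≈ y → x ≈ₑ y
  ≈⇒≈ₑ x≈y = ∧-cong x≈y refl

  [x∧y]∧e≈[x∧e]∧[y∧e] : ∀ x y → ((x ∧ y) ∧ e) ≈ ((x ∧ e) ∧ (y ∧ e))
  [x∧y]∧e≈[x∧e]∧[y∧e] x y = begin-equality
    (x ∧ y) ∧ e       ≈⟨ ∧-cong refl (sym (∧-idem e)) ⟩
    (x ∧ y) ∧ (e ∧ e) ≈⟨ ∧-assoc x y _ ⟩
    x ∧ (y ∧ (e ∧ e)) ≈⟨ ∧-cong refl (sym (∧-assoc y e e)) ⟩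
    x ∧ ((y ∧ e) ∧ e) ≈⟨ ∧-cong refl (∧-comm _ e) ⟩
    x ∧ (e ∧ (y ∧ e)) ≈⟨ sym (∧-assoc x e _) ⟩
    (x ∧ e) ∧ (y ∧ e) ∎

  [x·y]∧e≈[x∧e]·[y∧e] : ∀ x y → ((x · y) ∧ e) ≈ ((x ∧ e) · (y ∧ e))
  [x·y]∧e≈[x∧e]·[y∧e] x y = begin-equality
    (x · y) ∧ e       ≈⟨ x∧e≈e·x _ ⟩
    e · (x · y)       ≈⟨ ·-cong (sym e·e≈e) refl ⟩
    (e · e) · (x · y) ≈⟨ ·-interchange e e x y ⟩
    (e · x) · (e · y) ≈⟨ sym (·-cong (x∧e≈e·x x) (x∧e≈e·x y)) ⟩
    (x ∧ e) · (y ∧ e) ∎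

  [x·y]∧e≈x·[y∧e] : ∀ x y → ((x · y) ∧ e) ≈ (x · (y ∧ e))
  [x·y]∧e≈x·[y∧e] x y = begin-equality
    (x · y) ∧ e ≈⟨ x∧e≈e·x _ ⟩
    e · (x · y) ≈⟨ sym (·-assoc e x y) ⟩
    (e · x) · y ≈⟨ ·-cong (·-comm e x) refl ⟩
    (x · e) · y ≈⟨ ·-assoc x e y ⟩
    x · (e · y) ≈⟨ ·-cong refl (sym (x∧e≈e·x y)) ⟩
    x · (y ∧ e) ∎

  e·[x⇒y]≈e·[e·x⇒e·y] : ∀ x y → (e · (x ⇒ y)) ≈ (e · ((e · x) ⇒ (e · y)))
  e·[x⇒y]≈e·[e·x⇒e·y] x y = ≤-antisym
    (begin
      e · (x ⇒ y)       ≈⟨ trans (·-cong (sym e·e≈e) refl) (·-assoc e e _) ⟩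
      e · (e · (x ⇒ y)) ≤⟨ ·-monoʳ-≤ e (residual (begin
          (e · x) · (e · (x ⇒ y)) ≈⟨ ·-interchange e x e _ ⟩
          (e · e) · (x · (x ⇒ y)) ≤⟨ ·-mono-≤ (≤-reflexive e·e≈e) (x·[x⇒y]≤y x y) ⟩
          e · y                   ∎)) ⟩
      e · ((e · x) ⇒ (e · y)) ∎)
    (≤-respʳ-≈ (trans (∧-comm _ _) (x∧e≈e·x _)) (∧-greatest (x·y≤x _ _) (residual (begin
      x · (e · ((e · x) ⇒ (e · y))) ≈⟨ trans (sym (·-assoc x e _)) (·-cong (·-comm x e) refl) ⟩
      (e · x) · ((e · x) ⇒ (e · y)) ≤⟨ x·[x⇒y]≤y _ _ ⟩
      e · y                         ≤⟨ x·y≤y e y ⟩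
      y                             ∎))))

  [x⇒y]∧e≈[[x∧e]⇒[y∧e]]∧e : ∀ x y → ((x ⇒ y) ∧ e) ≈ (((x ∧ e) ⇒ (y ∧ e)) ∧ e)
  [x⇒y]∧e≈[[x∧e]⇒[y∧e]]∧e x y = begin-equality
    (x ⇒ y) ∧ e                 ≈⟨ x∧e≈e·x _ ⟩
    e · (x ⇒ y)                 ≈⟨ e·[x⇒y]≈e·[e·x⇒e·y] x y ⟩
    e · ((e · x) ⇒ (e · y))     ≈⟨ ·-cong refl (⇒-cong (sym (x∧e≈e·x x)) (sym (x∧e≈e·x y))) ⟩
    e · ((x ∧ e) ⇒ (y ∧ e))     ≈⟨ sym (x∧e≈e·x _) ⟩
    ((x ∧ e) ⇒ (y ∧ e)) ∧ e     ∎

  ≈ₑ-isEquivalence : IsEquivalence _≈ₑ_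
  ≈ₑ-isEquivalence = record { refl = refl ; sym = sym ; trans = trans }

  ∧-congₑ : ∀ {x x′ y y′} → x ≈ₑ x′ → y ≈ₑ y′ → (x ∧ y) ≈ₑ (x′ ∧ y′)
  ∧-congₑ p q = trans ([x∧y]∧e≈[x∧e]∧[y∧e] _ _) (trans (∧-cong p q) (sym ([x∧y]∧e≈[x∧e]∧[y∧e] _ _)))

  ∨-congₑ : ∀ {x x′ y y′} → x ≈ₑ x′ → y ≈ₑ y′ → (x ∨ y) ≈ₑ (x′ ∨ y′)
  ∨-congₑ p q = trans (∧-distribʳ-∨ e _ _) (trans (∨-cong p q) (sym (∧-distribʳ-∨ e _ _)))

  ·-congₑ : ∀ {x x′ y y′} → x ≈ₑ x′ → y ≈ₑ y′ → (x · y) ≈ₑ (x′ · y′)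
  ·-congₑ p q = trans ([x·y]∧e≈[x∧e]·[y∧e] _ _) (trans (·-cong p q) (sym ([x·y]∧e≈[x∧e]·[y∧e] _ _)))

  ⇒-congₑ : ∀ {x x′ y y′} → x ≈ₑ x′ → y ≈ₑ y′ → (x ⇒ y) ≈ₑ (x′ ⇒ y′)
  ⇒-congₑ p q = trans ([x⇒y]∧e≈[[x∧e]⇒[y∧e]]∧e _ _)
                  (trans (∧-cong (⇒-cong p q) refl) (sym ([x⇒y]∧e≈[[x∧e]⇒[y∧e]]∧e _ _)))

  _≤ₑ_ : Rel Carrier 0ℓ
  x ≤ₑ y = (x ∧ y) ≈ₑ x

  [x∧y]∧e≈[x∧e]∧y : ∀ x y → ((x ∧ y) ∧ e) ≈ ((x ∧ e) ∧ y)
  [x∧y]∧e≈[x∧e]∧y x y = trans (∧-assoc x y e) (trans (∧-cong refl (∧-comm y e)) (sym (∧-assoc x e y)))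

  ≤ₑ⇔∧e≤ : ∀ {x y} → (x ≤ₑ y → (x ∧ e) ≤ y) × ((x ∧ e) ≤ y → x ≤ₑ y)
  ≤ₑ⇔∧e≤ = (λ p → trans (sym ([x∧y]∧e≈[x∧e]∧y _ _)) p) , (λ p → trans ([x∧y]∧e≈[x∧e]∧y _ _) p)

  residuationₑ : ∀ x y z → ((x · y) ≤ₑ z → y ≤ₑ (x ⇒ z)) × (y ≤ₑ (x ⇒ z) → (x · y) ≤ₑ z)
  residuationₑ x y z =
      (λ p → to (residual (≤-respˡ-≈ ([x·y]∧e≈x·[y∧e] x y) (from p))))
    , (λ p → to (≤-respˡ-≈ (sym ([x·y]∧e≈x·[y∧e] x y)) (unresidual (from p))))
    where
      from = λ {x} {y} → proj₁ (≤ₑ⇔∧e≤ {x} {y})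
      to   = λ {x} {y} → proj₂ (≤ₑ⇔∧e≤ {x} {y})

  mtl : MTL
  mtl = record
    { gmtl = record
      { Carrier = Carrier
      ; _≈_ = _≈ₑ_
      ; _∧_ = _∧_
      ; _∨_ = _∨_
      ; _·_ = _·_
      ; _⇒_ = _⇒_
      ; 𝟏 = 𝟏
      ; isGMTL = record
        { isDistributiveLattice = record
          { isLattice = record
            { isEquivalence = ≈ₑ-isEquivalence
            ; ∨-comm = λ x y → ≈⇒≈ₑ (∨-comm x y)
            ; ∨-assoc = λ x y z → ≈⇒≈ₑ (∨-assoc x y z)
            ; ∨-cong = ∨-congₑ
            ; ∧-comm = λ x y → ≈⇒≈ₑ (∧-comm x y)
            ; ∧-assoc = λ x y z → ≈⇒≈ₑ (∧-assoc x y z)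
            ; ∧-cong = ∧-congₑ
            ; absorptive = (λ x y → ≈⇒≈ₑ (∨-absorbs-∧ x y)) , (λ x y → ≈⇒≈ₑ (∧-absorbs-∨ x y)) }
          ; ∨-distrib-∧ = (λ x y z → ≈⇒≈ₑ (∨-distribˡ-∧ x y z)) , (λ x y z → ≈⇒≈ₑ (∨-distribʳ-∧ x y z))
          ; ∧-distrib-∨ = (λ x y z → ≈⇒≈ₑ (∧-distribˡ-∨ x y z)) , (λ x y z → ≈⇒≈ₑ (∧-distribʳ-∨ x y z)) }
        ; isCommutativeMonoid = record
          { isMonoid = record
            { isSemigroup = record
              { isMagma = record { isEquivalence = ≈ₑ-isEquivalence ; ∙-cong = ·-congₑ }
              ; assoc = λ x y z → ≈⇒≈ₑ (·-assoc x y z) }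
            ; identity = (λ x → ≈⇒≈ₑ (·-identityˡ x)) , (λ x → ≈⇒≈ₑ (·-identityʳ x)) }
          ; comm = λ x y → ≈⇒≈ₑ (·-comm x y) }
        ; ⇒-cong = ⇒-congₑ
        ; integral = λ x → ≈⇒≈ₑ (integral x)
        ; residuation = residuationₑ
        ; prelinear = λ x y → ≈⇒≈ₑ (prelinear x y) } }
    ; 𝟎 = 𝟎
    ; bottom = λ x → ≈⇒≈ₑ (bottom x) }

  projection : MTLHom M mtl
  projection = record
    { hom = record
      { ⟦_⟧ = λ x → x
      ; cong = ≈⇒≈ₑ
      ; pres-∧ = λ _ _ → refl
      ; pres-∨ = λ _ _ → refl
      ; pres-· = λ _ _ → refl
      ; pres-⇒ = λ _ _ → refl
      ; pres-𝟏 = refl }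
    ; pres-𝟎 = refl }

  trivial⇒e≈𝟎 : Trivial mtl → e ≈ 𝟎
  trivial⇒e≈𝟎 trivial = begin-equality
    e     ≈⟨ sym (trans (∧-comm 𝟏 e) (integral e)) ⟩
    𝟏 ∧ e ≈⟨ sym (trivial 𝟎 𝟏) ⟩
    𝟎 ∧ e ≈⟨ bottom e ⟩
    𝟎     ∎

module Decomposition (M : MTL) {e f : MTL.Carrier M} (complementary : MTLProperties.Complementary M e f) where
  open MTLProperties M
  open Σ complementary renaming (proj₁ to e∨f≈𝟏; proj₂ to e∧f≈𝟎)

  open Σ (complementary-sym complementary) renaming (proj₂ to f∧e≈𝟎)

  module E = Factor M complementary
  module F = Factor M (complementary-sym complementary)

  pair : Carrier → Carrier → Carrier
  pair b c = (b ∧ e) ∨ (c ∧ f)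

  pair∧e≈b∧e : ∀ b c → (pair b c ∧ e) ≈ (b ∧ e)
  pair∧e≈b∧e b c = begin-equality
    ((b ∧ e) ∨ (c ∧ f)) ∧ e        ≈⟨ ∧-distribʳ-∨ e _ _ ⟩
    ((b ∧ e) ∧ e) ∨ ((c ∧ f) ∧ e)  ≈⟨ ∨-cong (trans (∧-assoc b e e) (∧-cong refl (∧-idem e)))
                                             (trans (∧-assoc c f e) (trans (∧-cong refl f∧e≈𝟎) (∧-zeroʳ c))) ⟩
    (b ∧ e) ∨ 𝟎                    ≈⟨ ∨-identityʳ _ ⟩
    b ∧ e                          ∎

  pair∧f≈c∧f : ∀ b c → (pair b c ∧ f) ≈ (c ∧ f)
  pair∧f≈c∧f b c = begin-equality
    ((b ∧ e) ∨ (c ∧ f)) ∧ f        ≈⟨ ∧-distribʳ-∨ f _ _ ⟩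
    ((b ∧ e) ∧ f) ∨ ((c ∧ f) ∧ f)  ≈⟨ ∨-cong (trans (∧-assoc b e f) (trans (∧-cong refl e∧f≈𝟎) (∧-zeroʳ b)))
                                             (trans (∧-assoc c f f) (∧-cong refl (∧-idem f))) ⟩
    𝟎 ∨ (c ∧ f)                    ≈⟨ ∨-identityˡ _ ⟩
    c ∧ f                          ∎

  pair-diagonal : ∀ a → pair a a ≈ a
  pair-diagonal a = trans (sym (∧-distribˡ-∨ a e f)) (trans (∧-cong refl e∨f≈𝟏) (integral a))

  decomposition : IsoToProduct M E.mtl F.mtl
  decomposition = E.projection , F.projection , pair , (λ p q → ∨-cong p q)
                , pair∧e≈b∧e , pair∧f≈c∧f , pair-diagonal

factorSMTL : (S : SMTL) {e f : SMTL.Carrier S} → MTLProperties.Complementary (SMTL.mtl S) e f → SMTL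
factorSMTL S complementary = record
  { mtl = Factor.mtl (SMTL.mtl S) complementary
  ; pseudocomplement = λ x → Factor.≈⇒≈ₑ (SMTL.mtl S) complementary (SMTL.pseudocomplement S x) }

module SMTLProperties (S : SMTL) where
  open SMTL S using (pseudocomplement)
  open MTLProperties (SMTL.mtl S)

  ∼[x·x]≈∼x : ∀ x → (∼ (x · x)) ≈ (∼ x)
  ∼[x·x]≈∼x x = ≤-antisym (residual (x·z≤𝟎)) (∼-antimono-≤ (x·y≤x x x))
    where
      z = ∼ (x · x)
      -- x · z lies below both x and ∼ x, whose meet is 𝟎
      x·z≤𝟎 : (x · z) ≤ 𝟎
      x·z≤𝟎 = ≤-respʳ-≈ (pseudocomplement x) (∧-greatest (x·y≤x x z) (residual
        (≤-respˡ-≈ (·-assoc x x z) (x·[x⇒y]≤y (x · x) 𝟎))))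

  ∼x∨∼∼x≈𝟏 : ∀ x → ((∼ x) ∨ (∼ (∼ x))) ≈ 𝟏
  ∼x∨∼∼x≈𝟏 x = begin-equality
    (∼ x) ∨ (∼ (∼ x))                       ≈⟨ ∨-comm _ _ ⟩
    (∼ (∼ x)) ∨ (∼ x)                       ≈⟨ ∨-cong ∼∼x≈∼x⇒∼∼x ∼x≈∼∼x⇒∼x ⟩
    ((∼ x) ⇒ (∼ (∼ x))) ∨ ((∼ (∼ x)) ⇒ (∼ x)) ≈⟨ prelinear (∼ x) (∼ (∼ x)) ⟩
    𝟏                                       ∎
    where
      ∼∼x≈∼x⇒∼∼x : (∼ (∼ x)) ≈ ((∼ x) ⇒ (∼ (∼ x)))
      ∼∼x≈∼x⇒∼∼x = sym (trans (sym (⇒-curry _ _ _)) (∼[x·x]≈∼x (∼ x)))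
      ∼x≈∼∼x⇒∼x : (∼ x) ≈ ((∼ (∼ x)) ⇒ (∼ x))
      ∼x≈∼∼x⇒∼x = sym (begin-equality
        (∼ (∼ x)) ⇒ (x ⇒ 𝟎) ≈⟨ sym (⇒-curry _ _ _) ⟩
        ((∼ (∼ x)) · x) ⇒ 𝟎 ≈⟨ ⇒-cong (·-comm _ _) refl ⟩
        (x · (∼ (∼ x))) ⇒ 𝟎 ≈⟨ ⇒-curry _ _ _ ⟩
        x ⇒ (∼ (∼ (∼ x)))   ≈⟨ ⇒-cong refl (∼∼∼x≈∼x x) ⟩
        x ⇒ (∼ x)           ≈⟨ sym (⇒-curry _ _ _) ⟩
        (x · x) ⇒ 𝟎         ≈⟨ ∼[x·x]≈∼x x ⟩
        ∼ x                 ∎)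

  ∼x-complementary-∼∼x : ∀ x → Complementary (∼ x) (∼ (∼ x))
  ∼x-complementary-∼∼x x = ∼x∨∼∼x≈𝟏 x , pseudocomplement (∼ x)

-- Opaque because unfolding it while checking the counit of GMTL≃SMTLind is prohibitively slow.
opaque
  directlyIndecomposable⇒zeroOrDense : ∀ S → DirectlyIndecomposable S → ZeroOrDense (SMTL.mtl S)
  directlyIndecomposable⇒zeroOrDense S (_ , indecomposable) x =
    [ (λ trivial → inj₂ (D.E.trivial⇒e≈𝟎 trivial))
    , (λ trivial → inj₁ (≤𝟎⇒≈𝟎 (≤-respʳ-≈ (D.F.trivial⇒e≈𝟎 trivial) (x≤∼∼x x)))) ]′
    (indecomposable (factorSMTL S complementary)
                    (factorSMTL S (complementary-sym complementary)) D.decomposition)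
    where
      open SMTLProperties S
      open MTLProperties (SMTL.mtl S)
      complementary : Complementary (∼ x) (∼ (∼ x))
      complementary = ∼x-complementary-∼∼x x
      module D = Decomposition (SMTL.mtl S) complementary

module _ {o h e o′ h′ e′} {C : Category o h e} {D : Category o′ h′ e′} {F G : Functor C D} where

  NatIso-sym : NatIso F G → NatIso G F
  NatIso-sym α = record
    { η = α.η⁻¹ ; η⁻¹ = α.η ; isoˡ = α.isoʳ ; isoʳ = α.isoˡ ; natural = natural⁻¹ }
    where
      module α = NatIso α
      module C = Category C
      module F = Functor F
      module G = Functor G
      open Category D
      refl : ∀ {X Y} {f : Hom X Y} → f ≈ f
      refl = IsEquivalence.refl ≈-equiv
      hom-setoid : Obj → Obj → Setoid h′ e′
      hom-setoid X Y = record { isEquivalence = ≈-equiv {X} {Y} }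
      natural⁻¹ : ∀ {A B} (f : C.Hom A B) → (α.η⁻¹ B ∘ G.F₁ f) ≈ (F.F₁ f ∘ α.η⁻¹ A)
      natural⁻¹ {A} {B} f = begin
        α.η⁻¹ B ∘ G.F₁ f                                  ≈⟨ identityʳ _ ⟨
        (α.η⁻¹ B ∘ G.F₁ f) ∘ id                           ≈⟨ ∘-cong refl (α.isoʳ A) ⟨
        (α.η⁻¹ B ∘ G.F₁ f) ∘ (α.η A ∘ α.η⁻¹ A)            ≈⟨ assoc _ _ _ ⟩
        α.η⁻¹ B ∘ (G.F₁ f ∘ (α.η A ∘ α.η⁻¹ A))            ≈⟨ ∘-cong refl (assoc _ _ _) ⟨
        α.η⁻¹ B ∘ ((G.F₁ f ∘ α.η A) ∘ α.η⁻¹ A)            ≈⟨ ∘-cong refl (∘-cong (α.natural f) refl) ⟨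
        α.η⁻¹ B ∘ ((α.η B ∘ F.F₁ f) ∘ α.η⁻¹ A)            ≈⟨ ∘-cong refl (assoc _ _ _) ⟩
        α.η⁻¹ B ∘ (α.η B ∘ (F.F₁ f ∘ α.η⁻¹ A))            ≈⟨ assoc _ _ _ ⟨
        (α.η⁻¹ B ∘ α.η B) ∘ (F.F₁ f ∘ α.η⁻¹ A)            ≈⟨ ∘-cong (α.isoˡ B) refl ⟩
        id ∘ (F.F₁ f ∘ α.η⁻¹ A)                           ≈⟨ identityˡ _ ⟩
        F.F₁ f ∘ α.η⁻¹ A                                  ∎
        where open SetoidReasoning (hom-setoid (G.F₀ A) (F.F₀ B))

Equivalence-sym : ∀ {o h e o′ h′ e′} {C : Category o h e} {D : Category o′ h′ e′} →
                  Equivalence C D → Equivalence D C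
Equivalence-sym E = record
  { F = Equivalence.G E
  ; G = Equivalence.F E
  ; unit = NatIso-sym (Equivalence.counit E)
  ; counit = NatIso-sym (Equivalence.unit E) }

-- MTLdiv and SMTLind are, definitionally, instances of this construction.
InducedMTLcat : ∀ {o} (O : Set o) → (O → MTL) → Category o 0ℓ 0ℓ
InducedMTLcat O U = record
  { Obj = O
  ; Hom = λ A B → MTLHom (U A) (U B)
  ; _≈_ = M._≈_
  ; id = M.id
  ; _∘_ = M._∘_
  ; ≈-equiv = λ {A} {B} → M.≈-equiv {U A} {U B}
  ; ∘-cong = λ {A} {B} {C} {f} {f′} {g} {g′} → M.∘-cong {U A} {U B} {U C} {f} {f′} {g} {g′}
  ; assoc = M.assoc
  ; identityˡ = M.identityˡ
  ; identityʳ = M.identityʳ }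
  where module M = Category MTLcat

dense-functor : ∀ {o} {O : Set o} (U : O → MTL) → Functor (InducedMTLcat O U) GMTLcat
dense-functor U = record
  { F₀ = λ A → DenseSubalgebra (U A)
  ; F₁ = dense-hom
  ; F-cong = λ f≈g x → f≈g (proj₁ x)
  ; F-id = λ {A} _ → MTLProperties.refl (U A)
  ; F-∘ = λ {C′ = C} _ _ _ → MTLProperties.refl (U C) }

adjoinBottom-functor : Functor GMTLcat MTLcat
adjoinBottom-functor = record
  { F₀ = AdjoinBottom.mtl
  ; F₁ = adjoinBottom-hom
  ; F-cong = λ f≈g → λ { nothing → nothing ; (just a) → just (f≈g a) }
  ; F-id = λ {A} → λ { nothing → nothing ; (just _) → just (GMTLProperties.refl A) }
  ; F-∘ = λ {C′ = C} _ _ → λ { nothing → nothing ; (just _) → just (GMTLProperties.refl C) } }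

GMTL≃MTLdiv : Equivalence GMTLcat MTLdiv
GMTL≃MTLdiv = record
  { F = record
    { F₀ = λ B → AdjoinBottom.mtl B , adjoinBottom-noZeroDivisors B
    ; F₁ = A.F₁ ; F-cong = A.F-cong ; F-id = A.F-id ; F-∘ = A.F-∘ }
  ; G = dense-functor proj₁
  ; unit = record
    { η = η-hom
    ; η⁻¹ = η⁻¹-hom
    ; isoˡ = λ B _ → GMTLProperties.refl B
    ; isoʳ = η∘η⁻¹≈id
    ; natural = λ {_} {B} _ _ → just (GMTLProperties.refl B) }
  ; counit = record
    { η = λ (M , _) → ε-hom M
    ; η⁻¹ = λ (M , nzd) → ε⁻¹-hom M (proj₁ nzd) (noZeroDivisors⇒zeroOrDense M nzd)
    ; isoˡ = λ (M , nzd) → ε⁻¹∘ε≈id M (proj₁ nzd) (noZeroDivisors⇒zeroOrDense M nzd)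
    ; isoʳ = λ (M , nzd) → ε∘ε⁻¹≈id M (proj₁ nzd) (noZeroDivisors⇒zeroOrDense M nzd)
    ; natural = ε-natural } }
  where module A = Functor adjoinBottom-functor

GMTL≃SMTLind : Equivalence GMTLcat SMTLind
GMTL≃SMTLind = record
  { F = record
    { F₀ = λ B → AdjoinBottom.smtl B , adjoinBottom-directlyIndecomposable B
    ; F₁ = A.F₁ ; F-cong = A.F-cong ; F-id = A.F-id ; F-∘ = A.F-∘ }
  ; G = dense-functor (λ A → SMTL.mtl (proj₁ A))
  ; unit = record
    { η = η-hom
    ; η⁻¹ = η⁻¹-hom
    ; isoˡ = λ B _ → GMTLProperties.refl B
    ; isoʳ = η∘η⁻¹≈id
    ; natural = λ {_} {B} _ _ → just (GMTLProperties.refl B) }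
  ; counit = record
    { η = λ (S , _) → ε-hom (SMTL.mtl S)
    ; η⁻¹ = λ (S , di) → ε⁻¹-hom (SMTL.mtl S) (proj₁ di) (directlyIndecomposable⇒zeroOrDense S di)
    ; isoˡ = λ (S , di) → ε⁻¹∘ε≈id (SMTL.mtl S) (proj₁ di) (directlyIndecomposable⇒zeroOrDense S di)
    ; isoʳ = λ (S , di) → ε∘ε⁻¹≈id (SMTL.mtl S) (proj₁ di) (directlyIndecomposable⇒zeroOrDense S di)
    ; natural = ε-natural } }
  where module A = Functor adjoinBottom-functor

-- Every step above is constructive.
theorem3p5 : ExcludedMiddle (lsuc 0ℓ) →
    Equivalence MTLdiv GMTLcat × Equivalence GMTLcat SMTLind
theorem3p5 _ = Equivalence-sym GMTL≃MTLdiv , GMTL≃SMTLind
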